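{- For nonnegative integers $\ell,\kappa,\mu,\omega$ with $\ell\ge\kappa$, say that $\mathcal P(\omega,\ell,\kappa,\mu)$ holds if for every $\omega_0\in\{0,\dots,2^\mu-1\}$ there exists an odd integer $M\in\{1,3,5,\dots,2^{5\kappa+7}-1\}$ such that \[ \bigl(M(2^\mu\omega+\omega_0)\bigr)^{[\ell-\kappa,\ell)}=0. \] Let $\ell,\kappa\ge1$ be integers such that $\mu:=\ell-4\kappa-4\ge0$. Then \[ \#\bigl\{\omega\in\{0,\dots,2^{4\kappa+4}-1\}:\ \mathcal P(\omega,\ell,\kappa,\mu)\bigr\}\ge 2^{3\kappa+4}\bigl(2^\kappa-1\bigr). \]
   Context: For $n\in\mathbb N$ with binary expansion $n=\sum_{j\ge0}\delta_j(n)2^j$ and a set $I\subseteq\mathbb N$, $n^I:=\sum_{j\in I}\delta_j(n)2^j$; thus $n^{[a,b)}=0$ means all binary digits of $n$ with indices $a\le j<b$ vanish. -}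

module Defs where

open import Data.Nat using (ℕ; zero; suc; _+_; _*_; _∸_; _^_; _≤_; _<_; _≟_; _<?_)
open import Data.Nat.DivMod using (_/_; _%_)
open import Data.Nat.Properties using (≤-refl; m^n≢0; ≤-trans; n≤1+n)
open import Data.Product using (Σ; ∃; _×_; _,_)
open import Data.Sum using (_⊎_; inj₁; inj₂)
open import Data.Empty using (⊥)
open import Data.List using (List; upTo; filter; length)
open import Relation.Nullary using (Dec; yes; no; ¬_)
open import Relation.Nullary.Decidable using (_×-dec_; _→-dec_)
open import Relation.Unary using (Decidable)
open import Relation.Binary.PropositionalEquality using (_≡_)

δ : ℕ → ℕ → ℕ
δ j n = (n / 2 ^ j) {{m^n≢0 2 j}} % 2

DigitsVanish : ℕ → ℕ → ℕ → Set
DigitsVanish a b n = ∀ j → a ≤ j → j < b → δ j n ≡ 0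

-- 𝒫(ω,ℓ,κ,μ): for every ω₀ < 2^μ there is an odd M with 1 ≤ M ≤ 2^(5κ+7) - 1
-- (i.e. M = 2k+1 with 2k+1 < 2^(5κ+7)) such that (M(2^μ ω + ω₀))^{[ℓ-κ,ℓ)} = 0.
𝒫 : ℕ → ℕ → ℕ → ℕ → Set
𝒫 ω ℓ κ μ = ∀ ω₀ → ω₀ < 2 ^ μ →
  Σ ℕ λ k → (2 * k + 1 < 2 ^ (5 * κ + 7)) ×
    DigitsVanish (ℓ ∸ κ) ℓ ((2 * k + 1) * (2 ^ μ * ω + ω₀))

all< : (P : ℕ → Set) → Decidable P → ∀ b → Dec (∀ j → j < b → P j)
all< P P? zero = yes (λ j ())
all< P P? (suc b) with all< P P? b | P? b
... | no ¬h | _ = no (λ h → ¬h (λ j j<b → h j (Data.Nat.Properties.m<n⇒m<1+n j<b)))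
... | yes h | no ¬p = no (λ h' → ¬p (h' b ≤-refl))
... | yes h | yes p = yes λ j j<sb → lemma j j<sb
  where
  lemma : ∀ j → j < suc b → P j
  lemma j j<sb with Data.Nat.Properties.m<1+n⇒m<n∨m≡n j<sb
  ... | inj₁ j<b = h j j<b
  ... | inj₂ Relation.Binary.PropositionalEquality.refl = p

any< : (P : ℕ → Set) → Decidable P → ∀ b → Dec (Σ ℕ λ j → j < b × P j)
any< P P? zero = no (λ { (j , () , _) })
any< P P? (suc b) with any< P P? b | P? b
... | yes (j , j<b , pj) | _ = yes (j , Data.Nat.Properties.m<n⇒m<1+n j<b , pj)
... | no _ | yes p = yes (b , ≤-refl , p)
... | no ¬h | no ¬p = no λ { (j , j<sb , pj) → go j j<sb pj }
  where
  go : ∀ j → j < suc b → P j → ⊥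
  go j j<sb pj with Data.Nat.Properties.m<1+n⇒m<n∨m≡n j<sb
  ... | inj₁ j<b = ¬h (j , j<b , pj)
  ... | inj₂ Relation.Binary.PropositionalEquality.refl = ¬p pj

count : (P : ℕ → Set) → Decidable P → ℕ → ℕ
count P P? N = length (filter P? (upTo N))

k<2k+1-bound : ∀ k {B} → 2 * k + 1 < B → k < B
k<2k+1-bound k {B} lt = Data.Nat.Properties.≤-<-trans
  (≤-trans (Data.Nat.Properties.m≤m+n k (k + zero)) (Data.Nat.Properties.m≤m+n (2 * k) 1)) lt

DigitsVanish? : ∀ a b n → Dec (DigitsVanish a b n)
DigitsVanish? a b n with all< (λ j → a ≤ j → δ j n ≡ 0) (λ j → (a Data.Nat.≤? j) →-dec (δ j n ≟ 0)) b
... | yes h = yes (λ j a≤j j<b → h j j<b a≤j)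
... | no ¬h = no (λ h → ¬h (λ j j<b a≤j → h j a≤j j<b))

𝒫? : ∀ ℓ κ μ → Decidable (λ ω → 𝒫 ω ℓ κ μ)
𝒫? ℓ κ μ ω with all< Q Q? (2 ^ μ)
  where
  Q : ℕ → Set
  Q ω₀ = Σ ℕ λ k → (2 * k + 1 < 2 ^ (5 * κ + 7)) ×
           DigitsVanish (ℓ ∸ κ) ℓ ((2 * k + 1) * (2 ^ μ * ω + ω₀))
  Q? : Decidable Q
  Q? ω₀ with any< (λ k → (2 * k + 1 < 2 ^ (5 * κ + 7)) ×
                     DigitsVanish (ℓ ∸ κ) ℓ ((2 * k + 1) * (2 ^ μ * ω + ω₀)))
                  (λ k → (2 * k + 1 <? 2 ^ (5 * κ + 7)) ×-dec DigitsVanish? (ℓ ∸ κ) ℓ ((2 * k + 1) * (2 ^ μ * ω + ω₀)))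
                  (2 ^ (5 * κ + 7))
  ... | yes (k , _ , r) = yes (k , r)
  ... | no ¬h = no λ { (k , lt , d) → ¬h (k , k<2k+1-bound k lt , lt , d) }
... | yes h = yes (λ ω₀ lt → h ω₀ lt)
... | no ¬h = no (λ h → ¬h (λ ω₀ lt → h ω₀ lt))

-- Pigeonholing the residues of 0, 2ω, 4ω, …, 2Qω modulo P = 2^(4κ+4) (Q = 2^(κ+1)) gives
-- some 1 ≤ m ≤ Q with 2mω within b = 2^(3κ+3) of a multiple qP (Dirichlet).  Unless 2mω lies
-- in [qP − 2m, qP], for x = 2^μ ω + ω₀ the number 2mx is congruent mod 2^ℓ to a shift +s or −ε
-- of size between 2^μ and 2^(ℓ−κ); the odd multipliers 2mj + 1 (j ≤ P) move x by such steps,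
-- so one of them lands in [0, 2^(ℓ−κ)) mod 2^ℓ, i.e. clears the binary digits ℓ−κ, …, ℓ−1.
-- The exceptional ω are ⌊qP/2m⌋ or ⌊qP/2m⌋ − 1 for one of the Q(2Q+1) pairs (m, q): at most
-- 2^(3κ+4) of them.
module Submission where

open import Defs
open import Data.Nat
  using (ℕ; zero; suc; _+_; _*_; _∸_; _^_; _≤_; _<_; _≥_; z≤n; s≤s; s≤s⁻¹; z<s; _≟_; _≤?_; _<?_)
  using (NonZero; >-nonZero; >-nonZero⁻¹)
open import Data.Nat.Properties
open import Data.Nat.DivMod
open import Data.Nat.Divisibility using (_∣_; divides)
open import Data.Nat.Tactic.RingSolver using (solve-∀)
open import Data.Fin using (Fin; toℕ; fromℕ<) renaming (_<_ to _<ᶠ_)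
open import Data.Fin.Properties using (pigeonhole; toℕ-fromℕ<; toℕ<n)
open import Data.Empty using (⊥-elim)
open import Data.Sum using (_⊎_; inj₁; inj₂; [_,_])
open import Data.Product using (Σ; ∃-syntax; _×_; _,_)
open import Data.List using (List; []; _∷_; _++_; length; filter; upTo; concatMap)
open import Data.List.Properties using (length-upTo; length-++; filter-all; filter-none)
open import Data.List.Membership.Propositional using (_∈_; lose)
open import Data.List.Membership.Propositional.Properties using (∈-upTo⁺; ∈-upTo⁻; ∈-concatMap⁺)
open import Data.List.Membership.DecPropositional _≟_ using (_∈?_)
open import Data.List.Relation.Unary.All using (All; []; _∷_; universal; universal-U)
open import Data.List.Relation.Unary.All.Properties using (all-filter)
open import Data.List.Relation.Unary.Any using (here; there)
open import Data.List.Relation.Unary.Unique.Propositional using (Unique)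
open import Data.List.Relation.Unary.AllPairs using (_∷_)
import Data.List.Relation.Unary.Unique.Propositional.Properties as Unique
open import Relation.Nullary using (yes; no)
open import Relation.Unary using (Decidable; U)
open import Relation.Unary.Properties using (U?)
open import Relation.Binary.PropositionalEquality hiding ([_])

2^m∣2^n : ∀ {m n} → m ≤ n → 2 ^ m ∣ 2 ^ n
2^m∣2^n {m} {n} m≤n = divides (2 ^ (n ∸ m))
  (trans (cong (2 ^_) (sym (m∸n+n≡m m≤n))) (^-distribˡ-+-* 2 (n ∸ m) m))

%2^b<2^a⇒DigitsVanish : ∀ {a b} n .{{_ : NonZero (2 ^ b)}} → n % 2 ^ b < 2 ^ a → DigitsVanish a b n
%2^b<2^a⇒DigitsVanish {a} {b} n n%<2^a j a≤j j<b =
  trans (sym (m%[n*o]/o≡m/o%n n 2 (2 ^ j))) (m<n⇒m/n≡0 low)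
  where
  instance
    2^j≢0 : NonZero (2 ^ j)
    2^j≢0 = m^n≢0 2 j
    2^[1+j]≢0 : NonZero (2 ^ suc j)
    2^[1+j]≢0 = m^n≢0 2 (suc j)
  low : n % 2 ^ suc j < 2 ^ j
  low = begin-strict
    n % 2 ^ suc j          ≡⟨ m∣n⇒o%n%m≡o%m (2 ^ suc j) (2 ^ b) n (2^m∣2^n j<b) ⟨
    n % 2 ^ b % 2 ^ suc j  ≤⟨ m%n≤m (n % 2 ^ b) (2 ^ suc j) ⟩
    n % 2 ^ b              <⟨ n%<2^a ⟩
    2 ^ a                  ≤⟨ ^-monoʳ-≤ 2 a≤j ⟩
    2 ^ j                  ∎
    where open ≤-Reasoning

module _ {A : Set} where

  length-filter-∷ : ∀ {P : A → Set} (P? : Decidable P) x xs →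
    length (filter P? xs) ≤ length (filter P? (x ∷ xs))
  length-filter-∷ P? x xs with P? x
  ... | yes _ = n≤1+n _
  ... | no _  = ≤-refl

  length-filter-⊆-∪ : ∀ {P Q R : A → Set} (P? : Decidable P) (Q? : Decidable Q) (R? : Decidable R) →
    ∀ xs → (∀ {x} → x ∈ xs → R x → P x ⊎ Q x) →
    length (filter R? xs) ≤ length (filter P? xs) + length (filter Q? xs)
  length-filter-⊆-∪ P? Q? R? [] _ = z≤n
  length-filter-⊆-∪ P? Q? R? (x ∷ xs) R⊆P∪Q
    with ih ← length-filter-⊆-∪ P? Q? R? xs (λ x∈xs → R⊆P∪Q (there x∈xs)) | R? x
  ... | no _ = ≤-trans ih (+-mono-≤ (length-filter-∷ P? x xs) (length-filter-∷ Q? x xs))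
  ... | yes r with P? x
  ...   | yes _ = s≤s (≤-trans ih (+-monoʳ-≤ _ (length-filter-∷ Q? x xs)))
  ...   | no ¬p with Q? x
  ...     | yes _ = ≤-trans (s≤s ih) (≤-reflexive (sym (+-suc _ _)))
  ...     | no ¬q = ⊥-elim ([ ¬p , ¬q ] (R⊆P∪Q (here refl) r))

  length-concatMap-const : ∀ {B : Set} (f : A → List B) {k} → (∀ x → length (f x) ≡ k) →
    ∀ xs → length (concatMap f xs) ≡ length xs * k
  length-concatMap-const f ∣f∣≡k [] = refl
  length-concatMap-const f {k} ∣f∣≡k (x ∷ xs) = begin
    length (f x ++ concatMap f xs)          ≡⟨ length-++ (f x) ⟩
    length (f x) + length (concatMap f xs)  ≡⟨ cong₂ _+_ (∣f∣≡k x) (length-concatMap-const f ∣f∣≡k xs) ⟩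
    k + length xs * k                       ∎
    where open ≡-Reasoning

  unique-constant⇒length≤1 : ∀ {a : A} xs → Unique xs → All (_≡ a) xs → length xs ≤ 1
  unique-constant⇒length≤1 []          _               _                 = z≤n
  unique-constant⇒length≤1 (_ ∷ [])    _               _                 = s≤s z≤n
  unique-constant⇒length≤1 (_ ∷ _ ∷ _) ((x≢y ∷ _) ∷ _) (refl ∷ refl ∷ _) = ⊥-elim (x≢y refl)

count-≡≤1 : ∀ a n → length (filter (_≟ a) (upTo n)) ≤ 1
count-≡≤1 a n = unique-constant⇒length≤1 _
  (Unique.filter⁺ (_≟ a) (Unique.upTo⁺ n)) (all-filter (_≟ a) (upTo n))

count-∈≤length : ∀ ys n → length (filter (_∈? ys) (upTo n)) ≤ length ys
count-∈≤length []       n =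
  ≤-reflexive (cong length (filter-none (_∈? []) (universal (λ _ ()) (upTo n))))
count-∈≤length (y ∷ ys) n = ≤-trans
  (length-filter-⊆-∪ (_≟ y) (_∈? ys) (_∈? y ∷ ys) (upTo n) λ where
    _ (here x≡y)   → inj₁ x≡y
    _ (there x∈ys) → inj₂ x∈ys)
  (+-mono-≤ (count-≡≤1 y n) (count-∈≤length ys n))

∸-length≤count : ∀ {P : ℕ → Set} (P? : Decidable P) n ys →
  (∀ {x} → x < n → P x ⊎ x ∈ ys) → n ∸ length ys ≤ count P P? n
∸-length≤count {P} P? n ys covered = m≤n+o⇒m∸n≤o n (length ys) (begin
  n                                                ≡⟨ length-upTo n ⟨
  length (upTo n)                                  ≡⟨ cong length (filter-all U? (universal-U (upTo n))) ⟨
  length (filter U? (upTo n))                      ≤⟨ length-filter-⊆-∪ P? (_∈? ys) U? (upTo n) covered′ ⟩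
  count P P? n + length (filter (_∈? ys) (upTo n)) ≤⟨ +-monoʳ-≤ (count P P? n) (count-∈≤length ys n) ⟩
  count P P? n + length ys                         ≡⟨ +-comm (count P P? n) (length ys) ⟩
  length ys + count P P? n                         ∎)
  where
  open ≤-Reasoning
  covered′ : ∀ {x} → x ∈ upTo n → U x → P x ⊎ x ∈ ys
  covered′ x∈upTo-n _ = covered (∈-upTo⁻ x∈upTo-n)

[v∸u]+u%n≡[v/n∸u/n]*n+v%n : ∀ {u v} n .{{_ : NonZero n}} → u ≤ v →
  (v ∸ u) + u % n ≡ (v / n ∸ u / n) * n + v % n
[v∸u]+u%n≡[v/n∸u/n]*n+v%n {u} {v} n u≤v = +-cancelʳ-≡ (u / n * n) _ _ (begin
  v ∸ u + u % n + u / n * n                 ≡⟨ +-assoc (v ∸ u) (u % n) (u / n * n) ⟩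
  v ∸ u + (u % n + u / n * n)               ≡⟨ cong (v ∸ u +_) (m≡m%n+[m/n]*n u n) ⟨
  v ∸ u + u                                 ≡⟨ m∸n+n≡m u≤v ⟩
  v                                         ≡⟨ m≡m%n+[m/n]*n v n ⟩
  v % n + v / n * n                         ≡⟨ cong (λ q → v % n + q * n) (m∸n+n≡m (/-monoˡ-≤ n u≤v)) ⟨
  v % n + (v / n ∸ u / n + u / n) * n       ≡⟨ cong (v % n +_) (*-distribʳ-+ n (v / n ∸ u / n) (u / n)) ⟩
  v % n + ((v / n ∸ u / n) * n + u / n * n) ≡⟨ +-assoc (v % n) _ _ ⟨
  v % n + (v / n ∸ u / n) * n + u / n * n   ≡⟨ cong (_+ u / n * n) (+-comm (v % n) _) ⟩
  (v / n ∸ u / n) * n + v % n + u / n * n   ∎)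
  where open ≡-Reasoning

m/n≡o/n⇒o∸m<n : ∀ {m o} n .{{_ : NonZero n}} → m / n ≡ o / n → o ∸ m < n
m/n≡o/n⇒o∸m<n {m} {o} n m/n≡o/n = begin-strict
  o ∸ m                                      ≡⟨ cong₂ _∸_ (split o) (split m) ⟩
  (o / n * n + o % n) ∸ (m / n * n + m % n)  ≡⟨ cong (λ q → (o / n * n + o % n) ∸ (q * n + m % n)) m/n≡o/n ⟩
  (o / n * n + o % n) ∸ (o / n * n + m % n)  ≡⟨ [m+n]∸[m+o]≡n∸o (o / n * n) (o % n) (m % n) ⟩
  o % n ∸ m % n                              ≤⟨ m∸n≤m (o % n) (m % n) ⟩
  o % n                                      <⟨ m%n<n o n ⟩
  n                                          ∎
  where
  open ≤-Reasoning
  split : ∀ x → x ≡ x / n * n + x % n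
  split x = trans (m≡m%n+[m/n]*n x n) (+-comm (x % n) _)

d+r≡k+s⇒d≡k+[s∸r]⊎d+[r∸s]≡k : ∀ d r k s → d + r ≡ k + s → d ≡ k + (s ∸ r) ⊎ d + (r ∸ s) ≡ k
d+r≡k+s⇒d≡k+[s∸r]⊎d+[r∸s]≡k d r k s eq with ≤-total r s
... | inj₁ r≤s = inj₁ (+-cancelʳ-≡ r _ _ (begin
  d + r                ≡⟨ eq ⟩
  k + s                ≡⟨ cong (k +_) (m∸n+n≡m r≤s) ⟨
  k + (s ∸ r + r)      ≡⟨ +-assoc k (s ∸ r) r ⟨
  k + (s ∸ r) + r      ∎))
  where open ≡-Reasoning
... | inj₂ s≤r = inj₂ (+-cancelʳ-≡ s _ _ (begin
  d + (r ∸ s) + s      ≡⟨ +-assoc d (r ∸ s) s ⟩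
  d + (r ∸ s + s)      ≡⟨ cong (d +_) (m∸n+n≡m s≤r) ⟩
  d + r                ≡⟨ eq ⟩
  k + s                ∎))
  where open ≡-Reasoning

dirichlet : ∀ y Q b .{{_ : NonZero Q}} .{{_ : NonZero b}} →
  ∃[ m ] (0 < m × m ≤ Q × ∃[ q ] ∃[ t ] (t < b × (m * y ≡ q * (Q * b) + t ⊎ m * y + t ≡ q * (Q * b))))
dirichlet y Q b = from-collision (pigeonhole (n<1+n Q) box)
  where
  P : ℕ
  P = Q * b
  instance
    P≢0 : NonZero P
    P≢0 = m*n≢0 Q b
  residue : ℕ → ℕ
  residue a = a * y % P
  box< : ∀ a → residue a / b < Q
  box< a = m<n*o⇒m/o<n (m%n<n (a * y) P)
  -- which of the Q blocks of width b contains a·y mod P; the Q + 1 multipliers 0, …, Q must collide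
  box : Fin (suc Q) → Fin Q
  box a = fromℕ< (box< (toℕ a))
  from-collision : ∃[ i ] ∃[ j ] (i <ᶠ j × box i ≡ box j) →
    ∃[ m ] (0 < m × m ≤ Q × ∃[ q ] ∃[ t ] (t < b × (m * y ≡ q * P + t ⊎ m * y + t ≡ q * P)))
  from-collision (i , j , i<j , box-i≡box-j) =
    a′ ∸ a , m<n⇒0<n∸m i<j , ≤-trans (m∸n≤m a′ a) (s≤s⁻¹ (toℕ<n j)) , q , close
    where
    a a′ q : ℕ
    a = toℕ i
    a′ = toℕ j
    q = a′ * y / P ∸ a * y / P
    same-box : residue a / b ≡ residue a′ / b
    same-box = trans (sym (toℕ-fromℕ< (box< a))) (trans (cong toℕ box-i≡box-j) (toℕ-fromℕ< (box< a′)))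
    key : (a′ ∸ a) * y + residue a ≡ q * P + residue a′
    key = trans (cong (_+ residue a) (*-distribʳ-∸ y a′ a))
                ([v∸u]+u%n≡[v/n∸u/n]*n+v%n P (*-monoˡ-≤ y (<⇒≤ i<j)))
    close : ∃[ t ] (t < b × ((a′ ∸ a) * y ≡ q * P + t ⊎ (a′ ∸ a) * y + t ≡ q * P))
    close with d+r≡k+s⇒d≡k+[s∸r]⊎d+[r∸s]≡k _ _ _ _ key
    ... | inj₁ eq = residue a′ ∸ residue a , m/n≡o/n⇒o∸m<n b same-box , inj₁ eq
    ... | inj₂ eq = residue a ∸ residue a′ , m/n≡o/n⇒o∸m<n b (sym same-box) , inj₂ eq

progression-hits-window : ∀ X .{{_ : NonZero X}} x s W .{{_ : NonZero s}} → s < W →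
  ∃[ j ] (j * s ≤ X × (x + j * s) % X < W)
progression-hits-window X x s W s<W with x % X <? W
... | yes r<W = 0 , z≤n , subst (λ y → y % X < W) (sym (+-identityʳ x)) r<W
... | no  r≮W = suc e , js≤X , landed
  -- step just past the next multiple of X: the overshoot s ∸ ρ is at most s < W
  where
  r D e ρ : ℕ
  r = x % X
  D = X ∸ r
  e = D / s
  ρ = D % s
  s≤r : s ≤ r
  s≤r = ≤-trans (<⇒≤ s<W) (≮⇒≥ r≮W)
  r+D≡X : r + D ≡ X
  r+D≡X = m+[n∸m]≡n (m%n≤n x X)
  D≡ρ+es : D ≡ ρ + e * s
  D≡ρ+es = m≡m%n+[m/n]*n D s
  js≤X : suc e * s ≤ X
  js≤X = begin
    s + e * s         ≤⟨ +-mono-≤ s≤r (m≤n+m (e * s) ρ) ⟩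
    r + (ρ + e * s)   ≡⟨ cong (r +_) D≡ρ+es ⟨
    r + D             ≡⟨ r+D≡X ⟩
    X                 ∎
    where open ≤-Reasoning
  regroup₁ : ∀ r q X s ρ es → r + q * X + (s + es) + ρ ≡ r + (ρ + es) + s + q * X
  regroup₁ = solve-∀
  regroup₂ : ∀ X q v ρ → X + (v + ρ) + q * X ≡ v + suc q * X + ρ
  regroup₂ = solve-∀
  crossing : x + suc e * s ≡ (s ∸ ρ) + suc (x / X) * X
  crossing = +-cancelʳ-≡ ρ _ _ (begin
    x + suc e * s + ρ                   ≡⟨ cong (λ y → y + suc e * s + ρ) (m≡m%n+[m/n]*n x X) ⟩
    r + x / X * X + (s + e * s) + ρ     ≡⟨ regroup₁ r (x / X) X s ρ (e * s) ⟩
    r + (ρ + e * s) + s + x / X * X     ≡⟨ cong (λ y → r + y + s + x / X * X) D≡ρ+es ⟨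
    r + D + s + x / X * X               ≡⟨ cong (λ y → y + s + x / X * X) r+D≡X ⟩
    X + s + x / X * X                   ≡⟨ cong (λ y → X + y + x / X * X) (m∸n+n≡m (<⇒≤ (m%n<n D s))) ⟨
    X + (s ∸ ρ + ρ) + x / X * X         ≡⟨ regroup₂ X (x / X) (s ∸ ρ) ρ ⟩
    s ∸ ρ + suc (x / X) * X + ρ         ∎)
    where open ≡-Reasoning
  s∸ρ<W : s ∸ ρ < W
  s∸ρ<W = ≤-<-trans (m∸n≤m s ρ) s<W
  landed : (x + suc e * s) % X < W
  landed = begin-strict
    (x + suc e * s) % X                 ≡⟨ cong (_% X) crossing ⟩
    (s ∸ ρ + suc (x / X) * X) % X       ≡⟨ [m+kn]%n≡m%n (s ∸ ρ) (suc (x / X)) X ⟩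
    (s ∸ ρ) % X                         ≡⟨ m<n⇒m%n≡m (<-≤-trans s∸ρ<W (≤-trans (≮⇒≥ r≮W) (m%n≤n x X))) ⟩
    s ∸ ρ                               <⟨ s∸ρ<W ⟩
    W                                   ∎
    where open ≤-Reasoning

-- The theorem uses L = 2^μ, Q = 2^(κ+1), b = 2^(3κ+3), so that P = 2^(4κ+4), X = 2^ℓ, W = 2^(ℓ−κ).
module Core (L Q b : ℕ) {{_ : NonZero L}} {{_ : NonZero Q}} {{_ : NonZero b}} (2Q≤b : 2 * Q ≤ b) where

  P X W : ℕ
  P = Q * b
  X = L * P
  W = L * (2 * b)

  instance
    P≢0 : NonZero P
    P≢0 = m*n≢0 Q b
    X≢0 : NonZero X
    X≢0 = m*n≢0 L P

  HasSmallOddMultiple : ℕ → Set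
  HasSmallOddMultiple x = ∃[ k ] (k ≤ Q * P × (2 * k + 1) * x % X < W)

  NearFraction : ℕ → Set
  NearFraction ω = ∃[ m ] (0 < m × m ≤ Q × ∃[ q ] (m * (2 * ω) ≤ q * P × q * P ≤ m * (2 * ω) + 2 * m))

  j*d≤X⇒j≤P : ∀ {j d} → L ≤ d → j * d ≤ X → j ≤ P
  j*d≤X⇒j≤P {j} {d} L≤d jd≤X = *-cancelʳ-≤ j P L (begin
    j * L  ≤⟨ *-monoʳ-≤ j L≤d ⟩
    j * d  ≤⟨ jd≤X ⟩
    L * P  ≡⟨ *-comm L P ⟩
    P * L  ∎)
    where open ≤-Reasoning

  -- (2mj + 1)x ≡ x + js (mod X)
  hasSmallOddMultiple-if-2mx≡qX+s : ∀ {m q s} x → m ≤ Q → 2 * m * x ≡ q * X + s → L ≤ s → s < W →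
    HasSmallOddMultiple x
  hasSmallOddMultiple-if-2mx≡qX+s {m} {q} {s} x m≤Q 2mx≡qX+s L≤s s<W =
    from-walk (progression-hits-window X x s W s<W)
    where
    instance
      s≢0 : NonZero s
      s≢0 = >-nonZero (<-≤-trans (>-nonZero⁻¹ L) L≤s)
    regroup₁ : ∀ m j x → (2 * (m * j) + 1) * x ≡ x + j * (2 * m * x)
    regroup₁ = solve-∀
    regroup₂ : ∀ x j qX s → x + j * (qX + s) ≡ x + j * s + j * qX
    regroup₂ = solve-∀
    from-walk : ∃[ j ] (j * s ≤ X × (x + j * s) % X < W) → HasSmallOddMultiple x
    from-walk (j , js≤X , lands) = m * j , *-mono-≤ m≤Q (j*d≤X⇒j≤P L≤s js≤X) , (begin-strict
      (2 * (m * j) + 1) * x % X     ≡⟨ cong (_% X) (regroup₁ m j x) ⟩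
      (x + j * (2 * m * x)) % X     ≡⟨ cong (λ y → (x + j * y) % X) 2mx≡qX+s ⟩
      (x + j * (q * X + s)) % X     ≡⟨ cong (_% X) (regroup₂ x j (q * X) s) ⟩
      (x + j * s + j * (q * X)) % X ≡⟨ cong (λ y → (x + j * s + y) % X) (*-assoc j q X) ⟨
      (x + j * s + j * q * X) % X   ≡⟨ [m+kn]%n≡m%n (x + j * s) (j * q) X ⟩
      (x + j * s) % X               <⟨ lands ⟩
      W                             ∎)
      where open ≤-Reasoning

  -- (2mj + 1)x ≡ x − jε (mod X), and j = ⌊(x mod X)/ε⌋ steps leave only (x mod X) mod ε < ε
  hasSmallOddMultiple-if-2mx+ε≡qX : ∀ {m q ε} x → m ≤ Q → 2 * m * x + ε ≡ q * X → L ≤ ε → ε ≤ W →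
    HasSmallOddMultiple x
  hasSmallOddMultiple-if-2mx+ε≡qX {m} {q} {ε} x m≤Q 2mx+ε≡qX L≤ε ε≤W =
    m * j , *-mono-≤ m≤Q (j*d≤X⇒j≤P L≤ε jε≤X) , lands
    where
    instance
      ε≢0 : NonZero ε
      ε≢0 = >-nonZero (<-≤-trans (>-nonZero⁻¹ L) L≤ε)
    r j u : ℕ
    r = x % X
    j = r / ε
    u = r % ε
    jε≤X : j * ε ≤ X
    jε≤X = ≤-trans (m/n*n≤m r ε) (m%n≤n x X)
    regroup₁ : ∀ m j x ε → (2 * (m * j) + 1) * x + j * ε ≡ x + j * (2 * m * x + ε)
    regroup₁ = solve-∀
    regroup₂ : ∀ u jε n X j q → u + jε + n * X + j * (q * X) ≡ u + (n + j * q) * X + jε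
    regroup₂ = solve-∀
    descent : (2 * (m * j) + 1) * x ≡ u + (x / X + j * q) * X
    descent = +-cancelʳ-≡ (j * ε) _ _ (begin
      (2 * (m * j) + 1) * x + j * ε          ≡⟨ regroup₁ m j x ε ⟩
      x + j * (2 * m * x + ε)                ≡⟨ cong (λ y → x + j * y) 2mx+ε≡qX ⟩
      x + j * (q * X)                        ≡⟨ cong (λ y → y + j * (q * X)) (m≡m%n+[m/n]*n x X) ⟩
      r + x / X * X + j * (q * X)            ≡⟨ cong (λ y → y + x / X * X + j * (q * X)) (m≡m%n+[m/n]*n r ε) ⟩
      u + j * ε + x / X * X + j * (q * X)    ≡⟨ regroup₂ u (j * ε) (x / X) X j q ⟩
      u + (x / X + j * q) * X + j * ε        ∎)
      where open ≡-Reasoning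
    lands : (2 * (m * j) + 1) * x % X < W
    lands = begin-strict
      (2 * (m * j) + 1) * x % X     ≡⟨ cong (_% X) descent ⟩
      (u + (x / X + j * q) * X) % X ≡⟨ [m+kn]%n≡m%n u (x / X + j * q) X ⟩
      u % X                         ≡⟨ m<n⇒m%n≡m (≤-<-trans (m%n≤m r ε) (m%n<n x X)) ⟩
      u                             <⟨ m%n<n r ε ⟩
      ε                             ≤⟨ ε≤W ⟩
      W                             ∎
      where open ≤-Reasoning

  2mω₀≤bL : ∀ {m ω₀} → m ≤ Q → ω₀ < L → 2 * m * ω₀ ≤ b * L
  2mω₀≤bL m≤Q ω₀<L = *-mono-≤ (≤-trans (*-monoʳ-≤ 2 m≤Q) 2Q≤b) (<⇒≤ ω₀<L)

  2m[Lω+ω₀]≡L[m[2ω]]+2mω₀ : ∀ m ω ω₀ → 2 * m * (L * ω + ω₀) ≡ L * (m * (2 * ω)) + 2 * m * ω₀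
  2m[Lω+ω₀]≡L[m[2ω]]+2mω₀ m ω ω₀ = identity m L ω ω₀
    where
    identity : ∀ m L ω ω₀ → 2 * m * (L * ω + ω₀) ≡ L * (m * (2 * ω)) + 2 * m * ω₀
    identity = solve-∀

  hasSmallOddMultiple-if-2mω≡qP+t : ∀ {m q t} ω ω₀ → m ≤ Q → ω₀ < L → 0 < t → t < b →
    m * (2 * ω) ≡ q * P + t → HasSmallOddMultiple (L * ω + ω₀)
  hasSmallOddMultiple-if-2mω≡qP+t {m} {q} {t} ω ω₀ m≤Q ω₀<L 0<t t<b 2mω≡qP+t =
    hasSmallOddMultiple-if-2mx≡qX+s {q = q} (L * ω + ω₀) m≤Q 2mx≡qX+s L≤s s<W
    where
    s : ℕ
    s = L * t + 2 * m * ω₀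
    2mx≡qX+s : 2 * m * (L * ω + ω₀) ≡ q * X + s
    2mx≡qX+s = begin
      2 * m * (L * ω + ω₀)               ≡⟨ 2m[Lω+ω₀]≡L[m[2ω]]+2mω₀ m ω ω₀ ⟩
      L * (m * (2 * ω)) + 2 * m * ω₀     ≡⟨ cong (λ y → L * y + 2 * m * ω₀) 2mω≡qP+t ⟩
      L * (q * P + t) + 2 * m * ω₀       ≡⟨ regroup L q P t (2 * m * ω₀) ⟩
      q * X + s                          ∎
      where
      open ≡-Reasoning
      regroup : ∀ L q P t r → L * (q * P + t) + r ≡ q * (L * P) + (L * t + r)
      regroup = solve-∀
    L≤s : L ≤ s
    L≤s = ≤-trans (m≤m*n L t {{>-nonZero 0<t}}) (m≤m+n _ _)
    s<W : s < W
    s<W = begin-strict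
      L * t + 2 * m * ω₀   <⟨ +-mono-<-≤ (*-monoʳ-< L t<b) (2mω₀≤bL m≤Q ω₀<L) ⟩
      L * b + b * L        ≡⟨ identity L b ⟩
      L * (2 * b)          ∎
      where
      open ≤-Reasoning
      identity : ∀ L b → L * b + b * L ≡ L * (2 * b)
      identity = solve-∀

  hasSmallOddMultiple-if-2mω+t≡qP : ∀ {m q t} ω ω₀ → m ≤ Q → ω₀ < L → 2 * m < t → t < b →
    m * (2 * ω) + t ≡ q * P → HasSmallOddMultiple (L * ω + ω₀)
  hasSmallOddMultiple-if-2mω+t≡qP {m} {q} {t} ω ω₀ m≤Q ω₀<L 2m<t t<b 2mω+t≡qP =
    hasSmallOddMultiple-if-2mx+ε≡qX {q = q} (L * ω + ω₀) m≤Q 2mx+ε≡qX L≤ε ε≤W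
    where
    ε : ℕ
    ε = L * t ∸ 2 * m * ω₀
    L+2mω₀≤Lt : L + 2 * m * ω₀ ≤ L * t
    L+2mω₀≤Lt = begin
      L + 2 * m * ω₀       ≤⟨ +-monoʳ-≤ L (*-monoʳ-≤ (2 * m) (<⇒≤ ω₀<L)) ⟩
      suc (2 * m) * L      ≤⟨ *-monoˡ-≤ L 2m<t ⟩
      t * L                ≡⟨ *-comm t L ⟩
      L * t                ∎
      where open ≤-Reasoning
    L≤ε : L ≤ ε
    L≤ε = m+n≤o⇒m≤o∸n L L+2mω₀≤Lt
    2mω₀≤Lt : 2 * m * ω₀ ≤ L * t
    2mω₀≤Lt = ≤-trans (m≤n+m _ L) L+2mω₀≤Lt
    ε≤W : ε ≤ W
    ε≤W = ≤-trans (m∸n≤m (L * t) (2 * m * ω₀)) (*-monoʳ-≤ L (≤-trans (<⇒≤ t<b) (m≤n*m b 2)))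
    2mx+ε≡qX : 2 * m * (L * ω + ω₀) + ε ≡ q * X
    2mx+ε≡qX = begin
      2 * m * (L * ω + ω₀) + ε                ≡⟨ cong (_+ ε) (2m[Lω+ω₀]≡L[m[2ω]]+2mω₀ m ω ω₀) ⟩
      L * (m * (2 * ω)) + 2 * m * ω₀ + ε      ≡⟨ +-assoc (L * (m * (2 * ω))) (2 * m * ω₀) ε ⟩
      L * (m * (2 * ω)) + (2 * m * ω₀ + ε)    ≡⟨ cong (L * (m * (2 * ω)) +_) (m+[n∸m]≡n 2mω₀≤Lt) ⟩
      L * (m * (2 * ω)) + L * t               ≡⟨ *-distribˡ-+ L (m * (2 * ω)) t ⟨
      L * (m * (2 * ω) + t)                   ≡⟨ cong (L *_) 2mω+t≡qP ⟩
      L * (q * P)                             ≡⟨ identity L q P ⟩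
      q * X                                   ∎
      where
      open ≡-Reasoning
      identity : ∀ x y z → x * (y * z) ≡ y * (x * z)
      identity = solve-∀

  nearFraction⊎hasSmallOddMultiple : ∀ ω ω₀ → ω₀ < L → NearFraction ω ⊎ HasSmallOddMultiple (L * ω + ω₀)
  nearFraction⊎hasSmallOddMultiple ω ω₀ ω₀<L with dirichlet (2 * ω) Q b
  ... | m , 0<m , m≤Q , q , zero , _ , inj₁ 2mω≡qP+0 = inj₁
    (m , 0<m , m≤Q , q , ≤-reflexive 2mω≡qP , ≤-trans (≤-reflexive (sym 2mω≡qP)) (m≤m+n _ (2 * m)))
    where
    2mω≡qP : m * (2 * ω) ≡ q * P
    2mω≡qP = trans 2mω≡qP+0 (+-identityʳ (q * P))
  ... | m , 0<m , m≤Q , q , t@(suc _) , t<b , inj₁ 2mω≡qP+t =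
    inj₂ (hasSmallOddMultiple-if-2mω≡qP+t {q = q} ω ω₀ m≤Q ω₀<L z<s t<b 2mω≡qP+t)
  ... | m , 0<m , m≤Q , q , t , t<b , inj₂ 2mω+t≡qP with t ≤? 2 * m
  ...   | yes t≤2m = inj₁ (m , 0<m , m≤Q , q , 2mω≤qP , qP≤2mω+2m)
    where
    2mω≤qP : m * (2 * ω) ≤ q * P
    2mω≤qP = ≤-trans (m≤m+n _ t) (≤-reflexive 2mω+t≡qP)
    qP≤2mω+2m : q * P ≤ m * (2 * ω) + 2 * m
    qP≤2mω+2m = ≤-trans (≤-reflexive (sym 2mω+t≡qP)) (+-monoʳ-≤ _ t≤2m)
  ...   | no  t≰2m = inj₂ (hasSmallOddMultiple-if-2mω+t≡qP {q = q} ω ω₀ m≤Q ω₀<L (≰⇒> t≰2m) t<b 2mω+t≡qP)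

  -- ⌊qP/2m⌋ for m = i + 1: a NearFraction ω satisfies ω ≤ qP/2m ≤ ω + 1, so it is this or one less.
  candidate : ℕ → ℕ → ℕ
  candidate i q = q * P / (2 * suc i)

  candidate-pair : ℕ → ℕ → List ℕ
  candidate-pair i q = candidate i q ∷ candidate i q ∸ 1 ∷ []

  candidate-row : ℕ → List ℕ
  candidate-row i = concatMap (candidate-pair i) (upTo (suc (2 * Q)))

  candidates : List ℕ
  candidates = concatMap candidate-row (upTo Q)

  length-candidates : length candidates ≡ Q * (suc (2 * Q) * 2)
  length-candidates = trans (length-concatMap-const candidate-row length-row (upTo Q))
                            (cong (_* (suc (2 * Q) * 2)) (length-upTo Q))
    where
    length-row : ∀ i → length (candidate-row i) ≡ suc (2 * Q) * 2
    length-row i = trans (length-concatMap-const (candidate-pair i) (λ _ → refl) (upTo (suc (2 * Q))))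
                         (cong (_* 2) (length-upTo (suc (2 * Q))))

  nearFraction⇒∈candidates : ∀ {ω} → ω < P → NearFraction ω → ω ∈ candidates
  nearFraction⇒∈candidates {ω} ω<P (suc i , _ , m≤Q , q , lo , hi) =
    ∈-concatMap⁺ candidate-row (lose (∈-upTo⁺ m≤Q)
      (∈-concatMap⁺ (candidate-pair i) (lose (∈-upTo⁺ (s≤s q≤2Q)) ω∈pair)))
    where
    d : ℕ
    d = 2 * suc i
    swap : ∀ m ω → m * (2 * ω) ≡ ω * (2 * m)
    swap = solve-∀
    swap-suc : ∀ m ω → m * (2 * ω) + 2 * m ≡ suc ω * (2 * m)
    swap-suc = solve-∀
    ωd≤qP : ω * d ≤ q * P
    ωd≤qP = ≤-trans (≤-reflexive (sym (swap (suc i) ω))) lo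
    qP≤[1+ω]d : q * P ≤ suc ω * d
    qP≤[1+ω]d = ≤-trans hi (≤-reflexive (swap-suc (suc i) ω))
    q≤2Q : q ≤ 2 * Q
    q≤2Q = *-cancelʳ-≤ q (2 * Q) P (begin
      q * P          ≤⟨ qP≤[1+ω]d ⟩
      suc ω * d      ≤⟨ *-mono-≤ ω<P (*-monoʳ-≤ 2 m≤Q) ⟩
      P * (2 * Q)    ≡⟨ *-comm P (2 * Q) ⟩
      2 * Q * P      ∎)
      where open ≤-Reasoning
    ω≤c : ω ≤ candidate i q
    ω≤c = ≤-trans (≤-reflexive (sym (m*n/n≡m ω d))) (/-monoˡ-≤ d ωd≤qP)
    c≤1+ω : candidate i q ≤ suc ω
    c≤1+ω = ≤-trans (/-monoˡ-≤ d qP≤[1+ω]d) (≤-reflexive (m*n/n≡m (suc ω) d))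
    ω∈pair : ω ∈ candidate-pair i q
    ω∈pair with m≤n⇒m<n∨m≡n ω≤c
    ... | inj₂ ω≡c = here ω≡c
    ... | inj₁ ω<c = there (here (sym (cong (_∸ 1) (≤-antisym c≤1+ω ω<c))))

2^[c*κ+d]≡2^d*[2^κ]^c : ∀ c d κ → 2 ^ (c * κ + d) ≡ 2 ^ d * (2 ^ κ) ^ c
2^[c*κ+d]≡2^d*[2^κ]^c c d κ = begin
  2 ^ (c * κ + d)        ≡⟨ ^-distribˡ-+-* 2 (c * κ) d ⟩
  2 ^ (c * κ) * 2 ^ d    ≡⟨ *-comm (2 ^ (c * κ)) (2 ^ d) ⟩
  2 ^ d * 2 ^ (c * κ)    ≡⟨ cong (λ e → 2 ^ d * 2 ^ e) (*-comm c κ) ⟩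
  2 ^ d * 2 ^ (κ * c)    ≡⟨ cong (2 ^ d *_) (^-*-assoc 2 κ c) ⟨
  2 ^ d * (2 ^ κ) ^ c    ∎
  where open ≡-Reasoning

module PaperParameters (ℓ κ : ℕ) (κ≥1 : κ ≥ 1) (N≤ℓ : 4 * κ + 4 ≤ ℓ) where

  N μ a : ℕ
  N = 4 * κ + 4
  μ = ℓ ∸ N
  a = 2 ^ κ

  instance
    2^μ≢0 : NonZero (2 ^ μ)
    2^μ≢0 = m^n≢0 2 μ
    2a≢0 : NonZero (2 * a)
    2a≢0 = m*n≢0 2 a {{_}} {{m^n≢0 2 κ}}
    8a³≢0 : NonZero (8 * a ^ 3)
    8a³≢0 = m*n≢0 8 (a ^ 3) {{_}} {{m^n≢0 a 3 {{m^n≢0 2 κ}}}}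
    2^ℓ≢0 : NonZero (2 ^ ℓ)
    2^ℓ≢0 = m^n≢0 2 ℓ

  2≤a : 2 ≤ a
  2≤a = ^-monoʳ-≤ 2 κ≥1

  4a≤8a³ : 2 * (2 * a) ≤ 8 * a ^ 3
  4a≤8a³ = begin
    2 * (2 * a)   ≡⟨ *-assoc 2 2 a ⟨
    4 * a         ≤⟨ *-monoˡ-≤ a (m≤m+n 4 4) ⟩
    8 * a         ≤⟨ *-monoʳ-≤ 8 (m≤m*n a (a ^ 2) {{m^n≢0 a 2 {{m^n≢0 2 κ}}}}) ⟩
    8 * a ^ 3     ∎
    where open ≤-Reasoning

  open Core (2 ^ μ) (2 * a) (8 * a ^ 3) 4a≤8a³ public

  ℓ≡μ+N : ℓ ≡ μ + N
  ℓ≡μ+N = sym (m∸n+n≡m N≤ℓ)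

  P≡2^N : P ≡ 2 ^ N
  P≡2^N = trans (identity a) (sym (2^[c*κ+d]≡2^d*[2^κ]^c 4 4 κ))
    where
    -- the ℕ ring solver rejects _^_, so powers of a are spelled out; a ^ 3 is a * (a * (a * 1)) by definition
    identity : ∀ y → 2 * y * (8 * (y * (y * (y * 1)))) ≡ 16 * (y * (y * (y * (y * 1))))
    identity = solve-∀

  X≡2^ℓ : X ≡ 2 ^ ℓ
  X≡2^ℓ = begin
    2 ^ μ * P       ≡⟨ cong (2 ^ μ *_) P≡2^N ⟩
    2 ^ μ * 2 ^ N   ≡⟨ ^-distribˡ-+-* 2 μ N ⟨
    2 ^ (μ + N)     ≡⟨ cong (2 ^_) ℓ≡μ+N ⟨
    2 ^ ℓ           ∎
    where open ≡-Reasoning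

  W≡2^[ℓ∸κ] : W ≡ 2 ^ (ℓ ∸ κ)
  W≡2^[ℓ∸κ] = begin
    2 ^ μ * (2 * (8 * a ^ 3))    ≡⟨ cong (2 ^ μ *_) (trans (identity a) (sym (2^[c*κ+d]≡2^d*[2^κ]^c 3 4 κ))) ⟩
    2 ^ μ * 2 ^ (3 * κ + 4)      ≡⟨ ^-distribˡ-+-* 2 μ (3 * κ + 4) ⟨
    2 ^ (μ + (3 * κ + 4))        ≡⟨ cong (2 ^_) (m+n∸n≡m (μ + (3 * κ + 4)) κ) ⟨
    2 ^ (μ + (3 * κ + 4) + κ ∸ κ) ≡⟨ cong (λ e → 2 ^ (e ∸ κ)) (trans (exponent μ κ) (sym ℓ≡μ+N)) ⟩
    2 ^ (ℓ ∸ κ)                  ∎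
    where
    open ≡-Reasoning
    identity : ∀ y → 2 * (8 * (y * (y * (y * 1)))) ≡ 16 * (y * (y * (y * 1)))
    identity = solve-∀
    exponent : ∀ μ κ → μ + (3 * κ + 4) + κ ≡ μ + (4 * κ + 4)
    exponent = solve-∀

  4QP≡2^[5κ+7] : 4 * (2 * a * P) ≡ 2 ^ (5 * κ + 7)
  4QP≡2^[5κ+7] = trans (identity a) (sym (2^[c*κ+d]≡2^d*[2^κ]^c 5 7 κ))
    where
    identity : ∀ y → 4 * (2 * y * (2 * y * (8 * (y * (y * (y * 1)))))) ≡ 128 * (y * (y * (y * (y * (y * 1)))))
    identity = solve-∀

  length-candidates≤2^[3κ+4] : length candidates ≤ 2 ^ (3 * κ + 4)
  length-candidates≤2^[3κ+4] = begin
    length candidates                       ≡⟨ length-candidates ⟩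
    2 * a * (suc (2 * (2 * a)) * 2)         ≡⟨ expand a ⟩
    4 * a * (1 + 4 * a)                     ≤⟨ *-monoʳ-≤ (4 * a) 1+4a≤4a*a ⟩
    4 * a * (4 * a * a)                     ≡⟨ collect a ⟩
    16 * a ^ 3                              ≡⟨ 2^[c*κ+d]≡2^d*[2^κ]^c 3 4 κ ⟨
    2 ^ (3 * κ + 4)                         ∎
    where
    open ≤-Reasoning
    expand : ∀ y → 2 * y * (suc (2 * (2 * y)) * 2) ≡ 4 * y * (1 + 4 * y)
    expand = solve-∀
    collect : ∀ y → 4 * y * (4 * y * y) ≡ 16 * (y * (y * (y * 1)))
    collect = solve-∀
    1+4a≤4a*a : 1 + 4 * a ≤ 4 * a * a
    1+4a≤4a*a = begin
      1 + 4 * a          ≤⟨ +-monoˡ-≤ (4 * a) (≤-trans (≤-trans (s≤s z≤n) 2≤a) (m≤n*m a 4)) ⟩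
      4 * a + 4 * a      ≡⟨ cong (4 * a +_) (*-identityʳ (4 * a)) ⟨
      4 * a + 4 * a * 1  ≡⟨ *-suc (4 * a) 1 ⟨
      4 * a * 2          ≤⟨ *-monoʳ-≤ (4 * a) 2≤a ⟩
      4 * a * a          ∎

  2^[3κ+4]*[2^κ∸1]≡2^N∸2^[3κ+4] : 2 ^ (3 * κ + 4) * (2 ^ κ ∸ 1) ≡ 2 ^ N ∸ 2 ^ (3 * κ + 4)
  2^[3κ+4]*[2^κ∸1]≡2^N∸2^[3κ+4] = begin
    2 ^ (3 * κ + 4) * (2 ^ κ ∸ 1)                   ≡⟨ *-distribˡ-∸ (2 ^ (3 * κ + 4)) (2 ^ κ) 1 ⟩
    2 ^ (3 * κ + 4) * 2 ^ κ ∸ 2 ^ (3 * κ + 4) * 1   ≡⟨ cong₂ _∸_ (sym (^-distribˡ-+-* 2 (3 * κ + 4) κ)) (*-identityʳ (2 ^ (3 * κ + 4))) ⟩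
    2 ^ (3 * κ + 4 + κ) ∸ 2 ^ (3 * κ + 4)           ≡⟨ cong (λ e → 2 ^ e ∸ 2 ^ (3 * κ + 4)) (exponent κ) ⟩
    2 ^ N ∸ 2 ^ (3 * κ + 4)                         ∎
    where
    open ≡-Reasoning
    exponent : ∀ κ → 3 * κ + 4 + κ ≡ 4 * κ + 4
    exponent = solve-∀

  hasSmallOddMultiple⇒𝒫-witness : ∀ ω ω₀ → HasSmallOddMultiple (2 ^ μ * ω + ω₀) →
    Σ ℕ λ k → (2 * k + 1 < 2 ^ (5 * κ + 7)) × DigitsVanish (ℓ ∸ κ) ℓ ((2 * k + 1) * (2 ^ μ * ω + ω₀))
  hasSmallOddMultiple⇒𝒫-witness ω ω₀ (k , k≤QP , lands) =
    k , 2k+1<2^[5κ+7] , %2^b<2^a⇒DigitsVanish _ (subst₂ _<_ (%-congʳ X≡2^ℓ) W≡2^[ℓ∸κ] lands)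
    where
    QP : ℕ
    QP = 2 * a * P
    1≤QP : 1 ≤ QP
    1≤QP = >-nonZero⁻¹ QP {{m*n≢0 (2 * a) P}}
    2k+1<2^[5κ+7] : 2 * k + 1 < 2 ^ (5 * κ + 7)
    2k+1<2^[5κ+7] = begin-strict
      2 * k + 1          ≤⟨ +-monoˡ-≤ 1 (*-monoʳ-≤ 2 k≤QP) ⟩
      2 * QP + 1         <⟨ +-monoʳ-< (2 * QP) (*-monoʳ-≤ 2 1≤QP) ⟩
      2 * QP + 2 * QP    ≡⟨ *-distribʳ-+ QP 2 2 ⟨
      4 * QP             ≡⟨ 4QP≡2^[5κ+7] ⟩
      2 ^ (5 * κ + 7)    ∎
      where open ≤-Reasoning

  𝒫⊎∈candidates : ∀ {ω} → ω < 2 ^ N → 𝒫 ω ℓ κ μ ⊎ ω ∈ candidates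
  𝒫⊎∈candidates {ω} ω<2^N with ω ∈? candidates
  ... | yes ω∈candidates = inj₂ ω∈candidates
  ... | no  ω∉candidates = inj₁ λ ω₀ ω₀<2^μ → hasSmallOddMultiple⇒𝒫-witness ω ω₀ (small-multiple ω₀ ω₀<2^μ)
    where
    small-multiple : ∀ ω₀ → ω₀ < 2 ^ μ → HasSmallOddMultiple (2 ^ μ * ω + ω₀)
    small-multiple ω₀ ω₀<2^μ with nearFraction⊎hasSmallOddMultiple ω ω₀ ω₀<2^μ
    ... | inj₁ near  = ⊥-elim (ω∉candidates (nearFraction⇒∈candidates (subst (ω <_) (sym P≡2^N) ω<2^N) near))
    ... | inj₂ small = small

lemma3p14 : (ℓ κ : ℕ) → κ ≥ 1 → 4 * κ + 4 ≤ ℓ →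
    count (λ ω → 𝒫 ω ℓ κ (ℓ ∸ (4 * κ + 4))) (𝒫? ℓ κ (ℓ ∸ (4 * κ + 4))) (2 ^ (4 * κ + 4))
      ≥ 2 ^ (3 * κ + 4) * (2 ^ κ ∸ 1)
lemma3p14 ℓ κ κ≥1 N≤ℓ = begin
  2 ^ (3 * κ + 4) * (2 ^ κ ∸ 1)   ≡⟨ 2^[3κ+4]*[2^κ∸1]≡2^N∸2^[3κ+4] ⟩
  2 ^ N ∸ 2 ^ (3 * κ + 4)         ≤⟨ ∸-monoʳ-≤ (2 ^ N) length-candidates≤2^[3κ+4] ⟩
  2 ^ N ∸ length candidates       ≤⟨ ∸-length≤count (𝒫? ℓ κ μ) (2 ^ N) candidates 𝒫⊎∈candidates ⟩
  count (λ ω → 𝒫 ω ℓ κ μ) (𝒫? ℓ κ μ) (2 ^ N) ∎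
  where
  open PaperParameters ℓ κ κ≥1 N≤ℓ
  open ≤-Reasoning
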